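{- Let $T$ be a binary phylogenetic $X$-tree, let $T'\subseteq T$, and let $S=\langle (x_1,y_1),\dots,(x_r,y_r)\rangle$ be a partial tree-child cherry picking sequence such that $(T\setminus T')\cap\{y_1,\dots,y_r\}=\emptyset$. Then $T'/S\subseteq T/S$.
   Context: A binary phylogenetic $X'$-tree is a rooted tree whose root has out-degree 2, whose internal non-root nodes have in-degree 1 and out-degree 2, and whose leaves are bijectively labelled by $X'$ (or a single node if $|X'|=1$). The restriction of a tree $T$ to a subset $X'$ of its labels is the smallest subtree of $T$ containing all paths between leaves in $X'$, with nodes of in- and out-degree 1 suppressed; we write $T'\subseteq T$ if $T'$ is the restriction of $T$ to some subset of its leaf labels, and $T\setminus T'$ denotes the set of labels of $T$ that are not labels of $T'$. A pair $\{x,y\}$ is a cherry of a tree if leaves $x,y$ are siblings. A partial cherry picking sequence is a sequence $S=\langle (x_1,y_1),\dots,(x_r,y_r)\rangle$ of pairs of elements of $X$; it is tree-child if $y_j\ne x_i$ for all $1\le i<j\le r$. Applying $S$ to a tree $T$ (on a subset of $X$): $T^{(0)}=T$, and for $j\le r$, if $\{x_j,y_j\}$ is a cherry of $T^{(j-1)}$ then $T^{(j)}$ is obtained by deleting leaf $x_j$ and suppressing the parent of $y_j$, otherwise $T^{(j)}=T^{(j-1)}$; $T/S=T^{(r)}$. -}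

module Defs where

open import Data.Bool using (Bool; true; false; _∧_; _∨_; if_then_else_)
open import Data.List using (List; []; _∷_; _++_; foldl)
open import Data.List.Relation.Unary.All using (All)
open import Data.List.Relation.Unary.Unique.Propositional using (Unique)
open import Data.Maybe using (Maybe; just; nothing)
open import Data.Product using (Σ; _×_; _,_; ∃-syntax)
open import Relation.Binary.Definitions using (DecidableEquality)
open import Relation.Binary.PropositionalEquality using (_≡_)
open import Relation.Nullary using (¬_)
open import Relation.Nullary.Decidable using (⌊_⌋)

-- A leaf alone is the one-node tree; every internal node has exactly two
-- children, so the root has out-degree 2 and non-root internal nodes have
-- in-degree 1 / out-degree 2. Children order is irrelevant (see _≅_).
data Tree (X : Set) : Set where
  leaf : X → Tree X
  node : Tree X → Tree X → Tree X

module _ {X : Set} where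

  leaves : Tree X → List X
  leaves (leaf a)   = a ∷ []
  leaves (node l r) = leaves l ++ leaves r

  Phylo : Tree X → Set
  Phylo T = Unique (leaves T)

  data _≅_ : Tree X → Tree X → Set where
    leaf≅ : ∀ a → leaf a ≅ leaf a
    straight : ∀ {l r l' r'} → l ≅ l' → r ≅ r' → node l r ≅ node l' r'
    crossed  : ∀ {l r l' r'} → l ≅ r' → r ≅ l' → node l r ≅ node l' r'

  -- restriction to the labels satisfying P (minimal subtree spanning them,
  -- with in/out-degree-1 nodes suppressed); nothing if no label survives
  restrict : (X → Bool) → Tree X → Maybe (Tree X)
  restrict P (leaf a) = if P a then just (leaf a) else nothing
  restrict P (node l r) with restrict P l | restrict P r
  ... | just l' | just r' = just (node l' r')
  ... | just l' | nothing = just l'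
  ... | nothing | just r' = just r'
  ... | nothing | nothing = nothing

  _⊆ₜ_ : Tree X → Tree X → Set
  T' ⊆ₜ T = ∃[ P ] ∃[ T'' ] (restrict P T ≡ just T'' × T'' ≅ T')

  TreeChild : List (X × X) → Set
  TreeChild []            = Data.Unit.⊤
    where import Data.Unit
  TreeChild ((x , y) ∷ S) = All (λ p → ¬ (Data.Product.proj₂ p ≡ x)) S × TreeChild S
    where import Data.Product

module WithDec {X : Set} (_≟_ : DecidableEquality X) where

  eqb : X → X → Bool
  eqb a b = ⌊ a ≟ b ⌋

  pick : X × X → Tree X → Tree X
  pick xy (leaf a) = leaf a
  pick (x , y) (node (leaf a) (leaf b)) =
    if (eqb a x ∧ eqb b y) ∨ (eqb a y ∧ eqb b x)
      then leaf y
      else node (leaf a) (leaf b)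
  pick xy (node (leaf a) (node l r)) = node (leaf a) (pick xy (node l r))
  pick xy (node (node l r) t) = node (pick xy (node l r)) (pick xy t)

  _/ₛ_ : Tree X → List (X × X) → Tree X
  T /ₛ S = foldl (λ t p → pick p t) T S

-- In a tree with distinct labels, picking a cherry (x , y) is restriction to the
-- labels other than x, and restricting twice is restricting to the intersection of
-- the label sets. Hence if T' is T restricted to P, then T'/(x , y) is T/(x , y)
-- restricted either to P or to P minus x: a cherry of T whose two labels survive
-- in T' is still a cherry of T' (this is where y must survive), and a cherry of T'
-- that is not one of T is removed by restricting further. The new label set differs
-- from P only at x, which by the tree-child condition is never a later y, so every
-- later y keeps surviving.
module Submission where

open import Defs
open import Data.List using (List; map)
open import Data.List.Membership.Propositional using (_∈_; _∉_)
open import Data.Product using (_×_; proj₂)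
open import Data.Empty using (⊥)
open import Relation.Binary.Definitions using (DecidableEquality)

open import Data.Bool using (Bool; true; false; _∧_; _∨_; not)
open import Data.Bool.Properties using (∧-comm; ∨-comm; ∧-identityʳ; ∨-zeroʳ)
open import Data.Empty using (⊥-elim)
open import Data.List using ([]; _∷_; _++_)
open import Data.List.Membership.Propositional.Properties using (∈-++⁺ˡ; ∈-++⁺ʳ; ∈-++⁻; ∈-map⁻)
open import Data.List.Relation.Binary.Disjoint.Propositional using (Disjoint)
open import Data.List.Relation.Unary.All as All using ([]; _∷_)
import Data.List.Relation.Unary.All.Properties as Allₚ
open import Data.List.Relation.Unary.AllPairs using ([]; _∷_)
open import Data.List.Relation.Unary.Any using (here; there)
open import Data.List.Relation.Unary.Unique.Propositional using (Unique)
import Data.List.Relation.Unary.Unique.Propositional.Properties as Uniqueₚ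
open import Data.Maybe using (Maybe; just; nothing)
open import Data.Maybe.Properties using (just-injective)
open import Data.Product using (Σ-syntax; ∃-syntax; _,_; proj₁)
open import Function using (_∘_)
open import Data.Sum using (inj₁; inj₂)
open import Relation.Nullary using (¬_; Dec; yes; no)
open import Relation.Nullary.Decidable using (isYes≗does; dec-true; dec-false)
open import Relation.Binary.PropositionalEquality
  using (_≡_; _≢_; refl; sym; trans; cong; cong₂; subst; module ≡-Reasoning)

false≢true : false ≢ true
false≢true ()

module _ {X : Set} where

  Unique-++⁻ : ∀ (xs : List X) {ys} → Unique (xs ++ ys) → Unique xs × Unique ys × Disjoint xs ys
  Unique-++⁻ []       u          = [] , u , λ { (() , _) }
  Unique-++⁻ (x ∷ xs) (x∉ ∷ u) with Unique-++⁻ xs u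
  ... | uxs , uys , xs#ys = Allₚ.++⁻ˡ xs x∉ ∷ uxs , uys , λ where
    (here refl  , z∈ys) → All.lookup (Allₚ.++⁻ʳ xs x∉) z∈ys refl
    (there z∈xs , z∈ys) → xs#ys (z∈xs , z∈ys)

  ≅-refl : (A : Tree X) → A ≅ A
  ≅-refl (leaf a)   = leaf≅ a
  ≅-refl (node l r) = straight (≅-refl l) (≅-refl r)

  ∈-leaves-≅ : ∀ {A B : Tree X} → A ≅ B → ∀ {z} → z ∈ leaves B → z ∈ leaves A
  ∈-leaves-≅ (leaf≅ a) z∈ = z∈
  ∈-leaves-≅ (straight {l} {r} {l'} l≅ r≅) z∈ with ∈-++⁻ (leaves l') z∈
  ... | inj₁ z∈l' = ∈-++⁺ˡ (∈-leaves-≅ l≅ z∈l')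
  ... | inj₂ z∈r' = ∈-++⁺ʳ (leaves l) (∈-leaves-≅ r≅ z∈r')
  ∈-leaves-≅ (crossed {l} {r} {l'} l≅ r≅) z∈ with ∈-++⁻ (leaves l') z∈
  ... | inj₁ z∈l' = ∈-++⁺ʳ (leaves l) (∈-leaves-≅ r≅ z∈l')
  ... | inj₂ z∈r' = ∈-++⁺ˡ (∈-leaves-≅ l≅ z∈r')

  nodeᵐ : Maybe (Tree X) → Maybe (Tree X) → Maybe (Tree X)
  nodeᵐ (just l) (just r) = just (node l r)
  nodeᵐ (just l) nothing  = just l
  nodeᵐ nothing  (just r) = just r
  nodeᵐ nothing  nothing  = nothing

  restrict-node : ∀ (P : X → Bool) l r → restrict P (node l r) ≡ nodeᵐ (restrict P l) (restrict P r)
  restrict-node P l r with restrict P l | restrict P r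
  ... | just _  | just _  = refl
  ... | just _  | nothing = refl
  ... | nothing | just _  = refl
  ... | nothing | nothing = refl

  restrict-leaf-true : ∀ (P : X → Bool) {a} → P a ≡ true → restrict P (leaf a) ≡ just (leaf a)
  restrict-leaf-true P Pa rewrite Pa = refl

  restrict-leaf-false : ∀ (P : X → Bool) {a} → P a ≡ false → restrict P (leaf a) ≡ nothing
  restrict-leaf-false P Pa rewrite Pa = refl

  restrict-leaves : ∀ (P : X → Bool) T {U} → restrict P T ≡ just U →
                    ∀ {z : X} → z ∈ leaves U → z ∈ leaves T × P z ≡ true
  restrict-leaves P (leaf a) eq z∈ with P a in Pa
  restrict-leaves P (leaf a) refl (here refl) | true = here refl , Pa
  restrict-leaves P (node l r) eq z∈ with restrict P l in el | restrict P r in er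
  restrict-leaves P (node l r) refl z∈ | just l' | just r' with ∈-++⁻ (leaves l') z∈
  ... | inj₁ z∈l' = let z∈l , Pz = restrict-leaves P l el z∈l' in ∈-++⁺ˡ z∈l , Pz
  ... | inj₂ z∈r' = let z∈r , Pz = restrict-leaves P r er z∈r' in ∈-++⁺ʳ (leaves l) z∈r , Pz
  restrict-leaves P (node l r) refl z∈ | just l' | nothing =
    let z∈l , Pz = restrict-leaves P l el z∈ in ∈-++⁺ˡ z∈l , Pz
  restrict-leaves P (node l r) refl z∈ | nothing | just r' =
    let z∈r , Pz = restrict-leaves P r er z∈ in ∈-++⁺ʳ (leaves l) z∈r , Pz

  restrict-≢-nothing : ∀ (P : X → Bool) T {z} → z ∈ leaves T → P z ≡ true → restrict P T ≢ nothing
  restrict-≢-nothing P (leaf a) (here refl) Pz eq with () ← trans (sym (restrict-leaf-true P Pz)) eq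
  restrict-≢-nothing P (node l r) z∈ Pz eq with restrict P l in el | restrict P r in er
  restrict-≢-nothing P (node l r) z∈ Pz () | just _ | just _
  restrict-≢-nothing P (node l r) z∈ Pz () | just _ | nothing
  restrict-≢-nothing P (node l r) z∈ Pz () | nothing | just _
  ... | nothing | nothing with ∈-++⁻ (leaves l) z∈
  ...   | inj₁ z∈l = restrict-≢-nothing P l z∈l Pz el
  ...   | inj₂ z∈r = restrict-≢-nothing P r z∈r Pz er

  Unique-restrict : ∀ (P : X → Bool) T {U} → Unique (leaves T) → restrict P T ≡ just U → Unique (leaves U)
  Unique-restrict P (leaf a) u eq with P a
  Unique-restrict P (leaf a) u refl | true = u
  Unique-restrict P (node l r) u eq with Unique-++⁻ (leaves l) u
  ... | ul , ur , l#r with restrict P l in el | restrict P r in er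
  Unique-restrict P (node l r) u refl | ul , ur , l#r | just l' | just r' =
    Uniqueₚ.++⁺ (Unique-restrict P l ul el) (Unique-restrict P r ur er)
      λ {z} (z∈l' , z∈r') → l#r (proj₁ (restrict-leaves P l el z∈l') , proj₁ (restrict-leaves P r er z∈r'))
  Unique-restrict P (node l r) u refl | ul , ur , l#r | just l' | nothing = Unique-restrict P l ul el
  Unique-restrict P (node l r) u refl | ul , ur , l#r | nothing | just r' = Unique-restrict P r ur er

  restrict-cong : ∀ (P Q : X → Bool) T → (∀ {z} → z ∈ leaves T → P z ≡ Q z) → restrict P T ≡ restrict Q T
  restrict-cong P Q (leaf a) P≗Q rewrite P≗Q (here refl) = refl
  restrict-cong P Q (node l r) P≗Q = begin
    restrict P (node l r)                       ≡⟨ restrict-node P l r ⟩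
    nodeᵐ (restrict P l) (restrict P r)         ≡⟨ cong₂ nodeᵐ (restrict-cong P Q l (P≗Q ∘ ∈-++⁺ˡ))
                                                               (restrict-cong P Q r (P≗Q ∘ ∈-++⁺ʳ (leaves l))) ⟩
    nodeᵐ (restrict Q l) (restrict Q r)         ≡⟨ restrict-node Q l r ⟨
    restrict Q (node l r)                       ∎
    where open ≡-Reasoning

  restrict-all : ∀ (P : X → Bool) T → (∀ {z} → z ∈ leaves T → P z ≡ true) → restrict P T ≡ just T
  restrict-all P (leaf a) Pall = restrict-leaf-true P (Pall (here refl))
  restrict-all P (node l r) Pall =
    trans (restrict-node P l r)
          (cong₂ nodeᵐ (restrict-all P l (Pall ∘ ∈-++⁺ˡ)) (restrict-all P r (Pall ∘ ∈-++⁺ʳ (leaves l))))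

  restrict-∧-nothing : ∀ (P Q : X → Bool) T → restrict P T ≡ nothing → restrict (λ z → P z ∧ Q z) T ≡ nothing
  restrict-∧-nothing P Q (leaf a) eq with P a
  restrict-∧-nothing P Q (leaf a) eq | false = refl
  restrict-∧-nothing P Q (node l r) eq with restrict P l in el | restrict P r in er
  restrict-∧-nothing P Q (node l r) () | just _  | just _
  restrict-∧-nothing P Q (node l r) () | just _  | nothing
  restrict-∧-nothing P Q (node l r) () | nothing | just _
  restrict-∧-nothing P Q (node l r) eq | nothing | nothing =
    trans (restrict-node _ l r) (cong₂ nodeᵐ (restrict-∧-nothing P Q l el) (restrict-∧-nothing P Q r er))

  nodeᵐ-nothingʳ : ∀ m → nodeᵐ m nothing ≡ m
  nodeᵐ-nothingʳ (just _) = refl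
  nodeᵐ-nothingʳ nothing  = refl

  nodeᵐ-nothingˡ : ∀ m → nodeᵐ nothing m ≡ m
  nodeᵐ-nothingˡ (just _) = refl
  nodeᵐ-nothingˡ nothing  = refl

  restrict-restrict : ∀ (P Q : X → Bool) T {V} → restrict P T ≡ just V →
                      restrict Q V ≡ restrict (λ z → P z ∧ Q z) T
  restrict-restrict P Q (leaf a) eq with P a
  restrict-restrict P Q (leaf a) refl | true = refl
  restrict-restrict P Q (node l r) eq with restrict P l in el | restrict P r in er
  restrict-restrict P Q (node l r) refl | just l' | just r' =
    trans (restrict-node Q l' r')
          (trans (cong₂ nodeᵐ (restrict-restrict P Q l el) (restrict-restrict P Q r er))
                 (sym (restrict-node _ l r)))
  restrict-restrict P Q (node l r) refl | just l' | nothing =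
    trans (restrict-restrict P Q l el)
          (sym (trans (restrict-node _ l r)
                      (trans (cong (nodeᵐ _) (restrict-∧-nothing P Q r er)) (nodeᵐ-nothingʳ _))))
  restrict-restrict P Q (node l r) refl | nothing | just r' =
    trans (restrict-restrict P Q r er)
          (sym (trans (restrict-node _ l r)
                      (trans (cong (λ m → nodeᵐ m _) (restrict-∧-nothing P Q l el)) (nodeᵐ-nothingˡ _))))

module _ {X : Set} (_≟_ : DecidableEquality X) where
  open WithDec _≟_

  eqb-refl : ∀ a → eqb a a ≡ true
  eqb-refl a = trans (isYes≗does (a ≟ a)) (dec-true (a ≟ a) refl)

  eqb-≢ : ∀ {a b} → a ≢ b → eqb a b ≡ false
  eqb-≢ {a} {b} a≢b = trans (isYes≗does (a ≟ b)) (dec-false (a ≟ b) a≢b)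

  eqb-true : ∀ {a b} → eqb a b ≡ true → a ≡ b
  eqb-true {a} {b} e with a ≟ b
  ... | yes a≡b = a≡b

  except : X → X → Bool
  except x z = not (eqb z x)

  except-self : ∀ x → except x x ≡ false
  except-self x rewrite eqb-refl x = refl

  except-≢ : ∀ {x z} → z ≢ x → except x z ≡ true
  except-≢ z≢x rewrite eqb-≢ z≢x = refl

  cherryᵇ : X → X → X → X → Bool
  cherryᵇ x y a b = (eqb a x ∧ eqb b y) ∨ (eqb a y ∧ eqb b x)

  data Cherry (x y : X) : Tree X → Set where
    here-xy : Cherry x y (node (leaf x) (leaf y))
    here-yx : Cherry x y (node (leaf y) (leaf x))
    left    : ∀ {l r} → Cherry x y l → Cherry x y (node l r)
    right   : ∀ {l r} → Cherry x y r → Cherry x y (node l r)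

  cherryᵇ-sound : ∀ {x y a b} → cherryᵇ x y a b ≡ true → Cherry x y (node (leaf a) (leaf b))
  cherryᵇ-sound {x} {y} {a} {b} e with eqb a x in ax | eqb b y in by | eqb a y in ay | eqb b x in bx
  ... | true | true | _ | _
    rewrite eqb-true ax | eqb-true by = here-xy
  ... | true | false | true | true
    rewrite eqb-true ay | eqb-true bx = here-yx
  ... | false | _ | true | true
    rewrite eqb-true ay | eqb-true bx = here-yx

  cherryᵇ-complete : ∀ {x y a b} → Cherry x y (node (leaf a) (leaf b)) → cherryᵇ x y a b ≡ true
  cherryᵇ-complete {x} {y} here-xy rewrite eqb-refl x | eqb-refl y = refl
  cherryᵇ-complete {x} {y} here-yx rewrite eqb-refl x | eqb-refl y = ∨-zeroʳ _

  cherry? : ∀ x y T → Dec (Cherry x y T)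
  cherry? x y (leaf a) = no λ ()
  cherry? x y (node (leaf a) (leaf b)) with cherryᵇ x y a b in e
  ... | true  = yes (cherryᵇ-sound e)
  ... | false = no λ c → false≢true (trans (sym e) (cherryᵇ-complete c))
  cherry? x y (node (leaf a) (node l r)) with cherry? x y (node l r)
  ... | yes c = yes (right c)
  ... | no ¬c = no λ { (left ()) ; (right c) → ¬c c }
  cherry? x y (node (node l r) t) with cherry? x y (node l r) | cherry? x y t
  ... | yes c  | _     = yes (left c)
  ... | no _   | yes c = yes (right c)
  ... | no ¬cl | no ¬cr = no λ { (left c) → ¬cl c ; (right c) → ¬cr c }

  Cherry-leaves : ∀ {x y T} → Cherry x y T → x ∈ leaves T × y ∈ leaves T
  Cherry-leaves here-xy = here refl , there (here refl)
  Cherry-leaves here-yx = there (here refl) , here refl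
  Cherry-leaves (left c)  = let x∈ , y∈ = Cherry-leaves c in ∈-++⁺ˡ x∈ , ∈-++⁺ˡ y∈
  Cherry-leaves {T = node l _} (right c) =
    let x∈ , y∈ = Cherry-leaves c in ∈-++⁺ʳ (leaves l) x∈ , ∈-++⁺ʳ (leaves l) y∈

  pick-¬Cherry : ∀ {x y} T → ¬ Cherry x y T → pick (x , y) T ≡ T
  pick-¬Cherry (leaf a) ¬c = refl
  pick-¬Cherry {x} {y} (node (leaf a) (leaf b)) ¬c with cherryᵇ x y a b in e
  ... | true  = ⊥-elim (¬c (cherryᵇ-sound e))
  ... | false = refl
  pick-¬Cherry (node (leaf a) (node l r)) ¬c =
    cong (node (leaf a)) (pick-¬Cherry (node l r) (λ c → ¬c (right c)))
  pick-¬Cherry (node (node l r) t) ¬c =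
    cong₂ node (pick-¬Cherry (node l r) (λ c → ¬c (left c))) (pick-¬Cherry t (λ c → ¬c (right c)))

  pick-∉ : ∀ {x y} T → x ∉ leaves T → pick (x , y) T ≡ T
  pick-∉ T x∉ = pick-¬Cherry T (λ c → x∉ (proj₁ (Cherry-leaves c)))

  pick-cherry : ∀ {x y a b} → Cherry x y (node (leaf a) (leaf b)) → pick (x , y) (node (leaf a) (leaf b)) ≡ leaf y
  pick-cherry c rewrite cherryᵇ-complete c = refl

  pick-nodeˡ : ∀ {x y l} r → Cherry x y l → pick (x , y) (node l r) ≡ node (pick (x , y) l) (pick (x , y) r)
  pick-nodeˡ {l = node _ _} r _ = refl

  pick-nodeʳ : ∀ {x y} l {r} → Cherry x y r → pick (x , y) (node l r) ≡ node (pick (x , y) l) (pick (x , y) r)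
  pick-nodeʳ (leaf _)   {node _ _} _ = refl
  pick-nodeʳ (node _ _) _            = refl

  restrict-except-∉ : ∀ {x} T → x ∉ leaves T → restrict (except x) T ≡ just T
  restrict-except-∉ T x∉ = restrict-all _ T λ {z} z∈ → except-≢ (λ { refl → x∉ z∈ })

  restrict-except≡pick : ∀ {x y} T → Unique (leaves T) → Cherry x y T →
                         restrict (except x) T ≡ just (pick (x , y) T)
  restrict-except≡pick {x} {y} _ ((x≢y ∷ []) ∷ _) here-xy =
    trans (restrict-node (except x) (leaf x) (leaf y))
          (trans (cong₂ nodeᵐ (restrict-leaf-false (except x) (except-self x))
                              (restrict-leaf-true (except x) (except-≢ λ y≡x → x≢y (sym y≡x))))
                 (cong just (sym (pick-cherry here-xy))))
  restrict-except≡pick {x} {y} _ ((y≢x ∷ []) ∷ _) here-yx =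
    trans (restrict-node (except x) (leaf y) (leaf x))
          (trans (cong₂ nodeᵐ (restrict-leaf-true (except x) (except-≢ y≢x))
                              (restrict-leaf-false (except x) (except-self x)))
                 (cong just (sym (pick-cherry here-yx))))
  restrict-except≡pick {x} {y} (node l r) u (left c) = begin
    restrict (except x) (node l r)                    ≡⟨ restrict-node _ l r ⟩
    nodeᵐ (restrict (except x) l) (restrict (except x) r)
      ≡⟨ cong₂ nodeᵐ (restrict-except≡pick l ul c) (restrict-except-∉ r x∉r) ⟩
    just (node (pick (x , y) l) r)                    ≡⟨ cong (λ t → just (node _ t)) (pick-∉ r x∉r) ⟨
    just (node (pick (x , y) l) (pick (x , y) r))     ≡⟨ cong just (pick-nodeˡ r c) ⟨
    just (pick (x , y) (node l r))                    ∎
    where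
      open ≡-Reasoning
      ul : Unique (leaves l)
      ul = proj₁ (Unique-++⁻ (leaves l) u)
      x∉r : x ∉ leaves r
      x∉r x∈r = proj₂ (proj₂ (Unique-++⁻ (leaves l) u)) (proj₁ (Cherry-leaves c) , x∈r)
  restrict-except≡pick {x} {y} (node l r) u (right c) = begin
    restrict (except x) (node l r)                    ≡⟨ restrict-node _ l r ⟩
    nodeᵐ (restrict (except x) l) (restrict (except x) r)
      ≡⟨ cong₂ nodeᵐ (restrict-except-∉ l x∉l) (restrict-except≡pick r ur c) ⟩
    just (node l (pick (x , y) r))                    ≡⟨ cong (λ t → just (node t _)) (pick-∉ l x∉l) ⟨
    just (node (pick (x , y) l) (pick (x , y) r))     ≡⟨ cong just (pick-nodeʳ l c) ⟨
    just (pick (x , y) (node l r))                    ∎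
    where
      open ≡-Reasoning
      ur : Unique (leaves r)
      ur = proj₁ (proj₂ (Unique-++⁻ (leaves l) u))
      x∉l : x ∉ leaves l
      x∉l x∈l = proj₂ (proj₂ (Unique-++⁻ (leaves l) u)) (x∈l , proj₁ (Cherry-leaves c))

  Cherry-restrict : ∀ (P : X → Bool) {x y} T {U} → Cherry x y T → restrict P T ≡ just U →
                    P x ≡ true → P y ≡ true → Cherry x y U
  Cherry-restrict P {x} {y} _ here-xy T|P Px Py =
    subst (Cherry x y) (just-injective (trans (sym T|P≡T) T|P)) here-xy
    where
      T|P≡T : restrict P (node (leaf x) (leaf y)) ≡ just (node (leaf x) (leaf y))
      T|P≡T = restrict-all P _ λ { (here refl) → Px ; (there (here refl)) → Py }
  Cherry-restrict P {x} {y} _ here-yx T|P Px Py =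
    subst (Cherry x y) (just-injective (trans (sym T|P≡T) T|P)) here-yx
    where
      T|P≡T : restrict P (node (leaf y) (leaf x)) ≡ just (node (leaf y) (leaf x))
      T|P≡T = restrict-all P _ λ { (here refl) → Py ; (there (here refl)) → Px }
  Cherry-restrict P (node l r) (left c) T|P Px Py with restrict P l in el | restrict P r in er
  Cherry-restrict P (node l r) (left c) refl Px Py | just l' | just r' = left (Cherry-restrict P l c el Px Py)
  Cherry-restrict P (node l r) (left c) refl Px Py | just l' | nothing = Cherry-restrict P l c el Px Py
  Cherry-restrict P (node l r) (left c) T|P Px Py | nothing | _ =
    ⊥-elim (restrict-≢-nothing P l (proj₁ (Cherry-leaves c)) Px el)
  Cherry-restrict P (node l r) (right c) T|P Px Py with restrict P l in el | restrict P r in er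
  Cherry-restrict P (node l r) (right c) refl Px Py | just l' | just r' = right (Cherry-restrict P r c er Px Py)
  Cherry-restrict P (node l r) (right c) refl Px Py | nothing | just r' = Cherry-restrict P r c er Px Py
  Cherry-restrict P (node l r) (right c) T|P Px Py | _ | nothing =
    ⊥-elim (restrict-≢-nothing P r (proj₁ (Cherry-leaves c)) Px er)

  Unique-pick : ∀ {x y} T → Unique (leaves T) → Unique (leaves (pick (x , y) T))
  Unique-pick {x} {y} T u with cherry? x y T
  ... | yes c = Unique-restrict (except x) T u (restrict-except≡pick T u c)
  ... | no ¬c rewrite pick-¬Cherry T ¬c = u

  ∈-leaves-pick : ∀ {x y} T → Unique (leaves T) → ∀ {z} → z ∈ leaves (pick (x , y) T) → z ∈ leaves T
  ∈-leaves-pick {x} {y} T u z∈ with cherry? x y T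
  ... | yes c = proj₁ (restrict-leaves (except x) T (restrict-except≡pick T u c) z∈)
  ... | no ¬c rewrite pick-¬Cherry T ¬c = z∈

  PickRestriction : X → X → Tree X → Tree X → (X → Bool) → Set
  PickRestriction x y T U P =
    Σ[ P' ∈ (X → Bool) ] restrict P' (pick (x , y) T) ≡ just (pick (x , y) U) × (∀ z → z ≢ x → P' z ≡ P z)

  pick-restrict-Cherry : ∀ {x y} T {U} (P : X → Bool) → Unique (leaves T) → restrict P T ≡ just U →
                         P y ≡ true → Cherry x y T → PickRestriction x y T U P
  pick-restrict-Cherry {x} {y} T {U} P u T|P Py cT with P x in Px
  ... | true = P , (begin
          restrict P (pick (x , y) T)                   ≡⟨ restrict-restrict (except x) P T pick-as-restrict ⟩
          restrict (λ z → except x z ∧ P z) T           ≡⟨ restrict-cong _ _ T (λ {z} _ → ∧-comm (except x z) (P z)) ⟩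
          restrict (λ z → P z ∧ except x z) T           ≡⟨ restrict-restrict P (except x) T T|P ⟨
          restrict (except x) U                         ≡⟨ restrict-except≡pick U (Unique-restrict P T u T|P) cU ⟩
          just (pick (x , y) U)                         ∎) , λ _ _ → refl
    where
      open ≡-Reasoning
      pick-as-restrict : restrict (except x) T ≡ just (pick (x , y) T)
      pick-as-restrict = restrict-except≡pick T u cT
      cU : Cherry x y U
      cU = Cherry-restrict P T cT T|P Px Py
  ... | false = P , (begin
          restrict P (pick (x , y) T)                   ≡⟨ restrict-restrict (except x) P T pick-as-restrict ⟩
          restrict (λ z → except x z ∧ P z) T           ≡⟨ restrict-cong _ _ T (λ {z} _ → except-∧-false z) ⟩
          restrict P T                                  ≡⟨ T|P ⟩
          just U                                        ≡⟨ cong just (pick-∉ U x∉U) ⟨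
          just (pick (x , y) U)                         ∎) , λ _ _ → refl
    where
      open ≡-Reasoning
      pick-as-restrict : restrict (except x) T ≡ just (pick (x , y) T)
      pick-as-restrict = restrict-except≡pick T u cT
      except-∧-false : ∀ z → except x z ∧ P z ≡ P z
      except-∧-false z with z ≟ x
      ... | yes refl = sym Px
      ... | no _     = refl
      x∉U : x ∉ leaves U
      x∉U x∈U = false≢true (trans (sym Px) (proj₂ (restrict-leaves P T T|P x∈U)))

  pick-restrict-¬Cherry : ∀ {x y} T {U} (P : X → Bool) → Unique (leaves T) → restrict P T ≡ just U →
                          ¬ Cherry x y T → PickRestriction x y T U P
  pick-restrict-¬Cherry {x} {y} T {U} P u T|P ¬cT with cherry? x y U
  ... | yes cU = (λ z → P z ∧ except x z) , (begin
          restrict (λ z → P z ∧ except x z) (pick (x , y) T) ≡⟨ cong (restrict _) (pick-¬Cherry T ¬cT) ⟩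
          restrict (λ z → P z ∧ except x z) T                ≡⟨ restrict-restrict P (except x) T T|P ⟨
          restrict (except x) U                              ≡⟨ restrict-except≡pick U (Unique-restrict P T u T|P) cU ⟩
          just (pick (x , y) U)                              ∎) ,
        λ z z≢x → trans (cong (P z ∧_) (except-≢ z≢x)) (∧-identityʳ (P z))
    where open ≡-Reasoning
  ... | no ¬cU = P , (begin
          restrict P (pick (x , y) T)                   ≡⟨ cong (restrict P) (pick-¬Cherry T ¬cT) ⟩
          restrict P T                                  ≡⟨ T|P ⟩
          just U                                        ≡⟨ cong just (pick-¬Cherry U ¬cU) ⟨
          just (pick (x , y) U)                         ∎) , λ _ _ → refl
    where open ≡-Reasoning

  pick-restrict : ∀ {x y} T {U} (P : X → Bool) → Unique (leaves T) → restrict P T ≡ just U →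
                  (y ∈ leaves T → P y ≡ true) → PickRestriction x y T U P
  pick-restrict {x} {y} T P u T|P keeps-y with cherry? x y T
  ... | yes cT = pick-restrict-Cherry T P u T|P (keeps-y (proj₂ (Cherry-leaves cT))) cT
  ... | no ¬cT = pick-restrict-¬Cherry T P u T|P ¬cT

  restrict-/ₛ : ∀ S T {U} (P : X → Bool) → Unique (leaves T) → restrict P T ≡ just U → TreeChild S →
                (∀ y → y ∈ map proj₂ S → y ∈ leaves T → P y ≡ true) →
                ∃[ P' ] restrict P' (T /ₛ S) ≡ just (U /ₛ S)
  restrict-/ₛ []            T P u T|P _              _    = P , T|P
  restrict-/ₛ ((x , y) ∷ S) T P u T|P (ys≢x , tc) keeps
    with pick-restrict T P u T|P (keeps y (here refl))
  ... | P' , pickT|P' , P'≗P = restrict-/ₛ S (pick (x , y) T) P' (Unique-pick T u) pickT|P' tc keeps'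
    where
      keeps' : ∀ y' → y' ∈ map proj₂ S → y' ∈ leaves (pick (x , y) T) → P' y' ≡ true
      keeps' y' y'∈S y'∈ with ∈-map⁻ proj₂ y'∈S
      ... | _ , p∈S , refl =
        trans (P'≗P y' (All.lookup ys≢x p∈S)) (keeps y' (there y'∈S) (∈-leaves-pick T u y'∈))

  cherryᵇ-swap : ∀ x y a b → cherryᵇ x y a b ≡ cherryᵇ x y b a
  cherryᵇ-swap x y a b =
    trans (∨-comm (eqb a x ∧ eqb b y) (eqb a y ∧ eqb b x))
          (cong₂ _∨_ (∧-comm (eqb a y) (eqb b x)) (∧-comm (eqb a x) (eqb b y)))

  pick-swap-leaves : ∀ {x y} a b → pick (x , y) (node (leaf a) (leaf b)) ≅ pick (x , y) (node (leaf b) (leaf a))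
  pick-swap-leaves {x} {y} a b rewrite cherryᵇ-swap x y a b with cherryᵇ x y b a
  ... | true  = leaf≅ y
  ... | false = crossed (leaf≅ a) (leaf≅ b)

  -- pick descends into a node only once it sees that its children are not two
  -- leaves, so the clauses expose the constructors of both subtrees.
  pick-≅ : ∀ p {A B : Tree X} → A ≅ B → pick p A ≅ pick p B
  pick-≅ p (leaf≅ a) = leaf≅ a
  pick-≅ p (straight {leaf _} {leaf _} (leaf≅ _) (leaf≅ _)) = ≅-refl _
  pick-≅ p (straight {leaf a} {node _ _} (leaf≅ _) r≅@(straight _ _)) = straight (leaf≅ a) (pick-≅ p r≅)
  pick-≅ p (straight {leaf a} {node _ _} (leaf≅ _) r≅@(crossed _ _))  = straight (leaf≅ a) (pick-≅ p r≅)
  pick-≅ p (straight {node _ _} l≅@(straight _ _) r≅) = straight (pick-≅ p l≅) (pick-≅ p r≅)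
  pick-≅ p (straight {node _ _} l≅@(crossed _ _)  r≅) = straight (pick-≅ p l≅) (pick-≅ p r≅)
  pick-≅ p (crossed {leaf a} {leaf b} (leaf≅ _) (leaf≅ _)) = pick-swap-leaves a b
  pick-≅ p (crossed {leaf a} {node _ _} (leaf≅ _) r≅@(straight _ _)) = crossed (leaf≅ a) (pick-≅ p r≅)
  pick-≅ p (crossed {leaf a} {node _ _} (leaf≅ _) r≅@(crossed _ _))  = crossed (leaf≅ a) (pick-≅ p r≅)
  pick-≅ p (crossed {node _ _} {leaf b} l≅@(straight _ _) (leaf≅ _)) = crossed (pick-≅ p l≅) (leaf≅ b)
  pick-≅ p (crossed {node _ _} {leaf b} l≅@(crossed _ _)  (leaf≅ _)) = crossed (pick-≅ p l≅) (leaf≅ b)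
  pick-≅ p (crossed {node _ _} {node _ _} l≅@(straight _ _) r≅@(straight _ _)) = crossed (pick-≅ p l≅) (pick-≅ p r≅)
  pick-≅ p (crossed {node _ _} {node _ _} l≅@(straight _ _) r≅@(crossed _ _))  = crossed (pick-≅ p l≅) (pick-≅ p r≅)
  pick-≅ p (crossed {node _ _} {node _ _} l≅@(crossed _ _)  r≅@(straight _ _)) = crossed (pick-≅ p l≅) (pick-≅ p r≅)
  pick-≅ p (crossed {node _ _} {node _ _} l≅@(crossed _ _)  r≅@(crossed _ _))  = crossed (pick-≅ p l≅) (pick-≅ p r≅)

  /ₛ-≅ : ∀ S {A B : Tree X} → A ≅ B → (A /ₛ S) ≅ (B /ₛ S)
  /ₛ-≅ []      A≅B = A≅B
  /ₛ-≅ (p ∷ S) A≅B = /ₛ-≅ S (pick-≅ p A≅B)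

lemma7 : {X : Set} (_≟_ : DecidableEquality X) (T T' : Tree X) →
    Phylo T → T' ⊆ₜ T →
    (S : List (X × X)) → TreeChild S →
    (∀ y → y ∈ map proj₂ S → y ∈ leaves T → y ∉ leaves T' → ⊥) →
    WithDec._/ₛ_ _≟_ T' S ⊆ₜ WithDec._/ₛ_ _≟_ T S
lemma7 _≟_ T T' uT (P , U , T|P , U≅T') S tc ys-in-T' =
  let P' , T/S|P' = restrict-/ₛ _≟_ S T P uT T|P tc ys-kept
  in P' , WithDec._/ₛ_ _≟_ U S , T/S|P' , /ₛ-≅ _≟_ S U≅T'
  where
    ys-kept : ∀ y → y ∈ map proj₂ S → y ∈ leaves T → P y ≡ true
    ys-kept y y∈S y∈T with P y in Py
    ... | true  = refl
    ... | false = ⊥-elim (ys-in-T' y y∈S y∈T λ y∈T' →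
                    false≢true (trans (sym Py) (proj₂ (restrict-leaves P T T|P (∈-leaves-≅ U≅T' y∈T')))))
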